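{- Let $k\ge3$, let $G$ be a graph, $H$ a cover of $G$ with colors $1,\dots,s$, and $F=(f_1,\dots,f_s)$ with $f_i(v)\in\{0,1,2\}$ for all $v,i$. Let $K\subseteq G$ be a subgraph with $V(K)=\{v_1,\ldots,v_m\}$ such that: (i) $k-(d_G(v_1)-d_K(v_1))\ge3$; (ii) $d_G(v_m)\le k$ and the neighbors of $v_m$ in $G$ that lie in $V(K)$ are exactly $v_1$ and $v_{m-1}$; (iii) for $2\le i\le m-1$, $v_i$ has at most $k-1$ neighbors in $G$ that lie in $\{v_1,\ldots,v_{i-1}\}\cup (V(G)\setminus V(K))$. If $|f(v)|\ge k$ for every vertex $v$, then every DP-$F$-coloring of $G-V(K)$ can be extended to a DP-$F$-coloring of $(G,H)$.
   Context: All graphs are finite, simple and undirected. A cover of $G$ with colors $1,\dots,s$ is a graph $H$ with vertex set $V(G)\times\{1,\dots,s\}$ such that: each $\{u\}\times\{1,\dots,s\}$ induces a complete graph; for each edge $uv\in E(G)$ the edges of $H$ between $\{u\}\times\{1,\dots,s\}$ and $\{v\}\times\{1,\dots,s\}$ form a (possibly empty) matching; if $uv\notin E(G)$ there are no such edges. $|f(v)|=f_1(v)+\cdots+f_s(v)$. For an induced subgraph $G'$, a representative set of $G'$ contains exactly one element of $\{v\}\times\{1,\dots,s\}$ for each $v\in V(G')$; a DP-$F$-coloring of $G'$ is a representative set $R$ of $G'$ that can be linearly ordered so that each $(v,i)\in R$ has fewer than $f_i(v)$ neighbors in $H$ among the elements of $R$ preceding it. A DP-$F$-coloring $R$ of $G$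 extends $R'$ if $R'\subseteq R$. -}

module Defs where

open import Data.Nat using (ℕ; zero; suc; _+_; _∸_; _≤_; _<_; _<ᵇ_)
open import Data.Bool using (Bool; true; false; T; _∧_; _∨_; not; if_then_else_)
open import Data.Fin using (Fin; zero; suc; toℕ; fromℕ; inject₁; _≟_)
open import Data.Product using (_×_; _,_; Σ; ∃)
open import Relation.Binary.PropositionalEquality using (_≡_; _≢_)
open import Relation.Nullary.Decidable using (⌊_⌋)

countFin : ∀ {n} → (Fin n → Bool) → ℕ
countFin {zero} P = 0
countFin {suc n} P = (if P zero then 1 else 0) + countFin (λ i → P (suc i))

sumFin : ∀ {n} → (Fin n → ℕ) → ℕ
sumFin {zero} g = 0
sumFin {suc n} g = g zero + sumFin (λ i → g (suc i))

anyFin : ∀ {n} → (Fin n → Bool) → Bool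
anyFin {zero} P = false
anyFin {suc n} P = P zero ∨ anyFin (λ i → P (suc i))

record Graph (n : ℕ) : Set where
  field
    adj   : Fin n → Fin n → Bool
    sym   : ∀ u v → adj u v ≡ adj v u
    irrefl : ∀ v → adj v v ≡ false
open Graph public

Edge : ∀ {n} → Graph n → Fin n → Fin n → Set
Edge G u v = T (adj G u v)

deg : ∀ {n} → Graph n → Fin n → ℕ
deg G v = countFin (adj G v)

-- a cover H of G with colours Fin s (colours 1..s of the paper);
-- H is a simple graph on Fin n × Fin s
record Cover {n : ℕ} (G : Graph n) (s : ℕ) : Set where
  field
    hadj     : Fin n × Fin s → Fin n × Fin s → Bool
    hsym     : ∀ x y → hadj x y ≡ hadj y x
    hirrefl  : ∀ x → hadj x x ≡ false
    fibre    : ∀ v i j → i ≢ j → T (hadj (v , i) (v , j))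
    cross    : ∀ u v i j → u ≢ v → T (hadj (u , i) (v , j)) → Edge G u v
    -- and they form a matching (other side follows by hsym)
    matching : ∀ u v i j j′ → u ≢ v → T (hadj (u , i) (v , j))
               → T (hadj (u , i) (v , j′)) → j ≡ j′
open Cover public

-- |f(v)| = f_1(v) + ... + f_s(v); here f v i = f_i(v)
size : ∀ {n s} → (Fin n → Fin s → ℕ) → Fin n → ℕ
size f v = sumFin (f v)

-- A representative set of the induced subgraph on S is encoded by a
-- colour choice c : Fin n → Fin s, of which only the values on S matter
-- (R = {(v , c v) | v ∈ S}).  A linear order of R is encoded by a rank
-- function r injective on S.
precNbrs : ∀ {n s} {G : Graph n} → Cover G s → (Fin n → Bool)
           → (Fin n → Fin s) → (Fin n → ℕ) → Fin n → ℕ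
precNbrs H S c r v =
  countFin (λ u → S u ∧ (r u <ᵇ r v) ∧ hadj H (v , c v) (u , c u))

IsDPFColoring : ∀ {n s} (G : Graph n) → Cover G s → (Fin n → Fin s → ℕ)
                → (Fin n → Bool) → (Fin n → Fin s) → Set
IsDPFColoring G H f S c =
  Σ (Fin n → ℕ) λ r →
    (∀ u v → T (S u) → T (S v) → r u ≡ r v → u ≡ v)
    × (∀ v → T (S v) → precNbrs H S c r v < f v (c v))
  where n = _

-- subgraph K of G with vertices v_1,...,v_m given by an injective list
-- vert : Fin m → Fin n (vert i = v_{i+1}) and its own edge set
record Subgraph {n : ℕ} (G : Graph n) (m : ℕ) : Set where
  field
    vert   : Fin m → Fin n
    vinj   : ∀ a b → vert a ≡ vert b → a ≡ b
    kadj   : Fin m → Fin m → Bool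
    ksym   : ∀ a b → kadj a b ≡ kadj b a
    kedge  : ∀ a b → T (kadj a b) → Edge G (vert a) (vert b)
open Subgraph public

degK : ∀ {n m} {G : Graph n} → Subgraph G m → Fin m → ℕ
degK K a = countFin (kadj K a)

inVK : ∀ {n m} {G : Graph n} → Subgraph G m → Fin n → Bool
inVK K u = anyFin (λ l → ⌊ vert K l ≟ u ⌋)

outsideK : ∀ {n m} {G : Graph n} → Subgraph G m → Fin n → Bool
outsideK K u = not (inVK K u)

-- u ∈ {v_1,...,v_{j}} ∪ (V(G) ∖ V(K)) , for 0-based index j (paper index j+1)
earlierOrOutside : ∀ {n m} {G : Graph n} → Subgraph G m → Fin m → Fin n → Bool
earlierOrOutside K j u =
  outsideK K u ∨ anyFin (λ l → (toℕ l <ᵇ toℕ j) ∧ ⌊ vert K l ≟ u ⌋)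

allTrue : ∀ {n} → Fin n → Bool
allTrue _ = true

module Submission where

-- Free colour: since cover
-- edges between two fibres form a matching, a vertex v with fewer than |f(v)|
-- coloured neighbours has a colour i hit fewer than f_i(v) times.  Extension:
-- a vertex may be added to a valid partial colouring if it has room itself and
-- every old vertex that it precedes can absorb it in its slack.
--
-- K is coloured in the order v_1, …, v_m, ranked above every outside vertex.
-- By (i), v_1 has room to avoid two prescribed colours; by (iii), v_2, …,
-- v_{m−1} are coloured greedily; by (ii), v_m has at most k − 1 (k − 2 if
-- m ≥ 3) outside neighbours.  If v_m has a colour with two spare units, or
-- m = 2, v_1 avoids its partner and v_m is coloured last.  Otherwise v_m has
-- two free colours j₁ ≠ j₂ and picks the one not adjacent to the copy of
-- v_{m−1}; to keep v_1 from blocking it, either v_1 avoids both partners, or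
-- v_1 has a colour with two spare units and v_m is ranked before v_1 instead.

open import Defs hiding (sym)
open import Algebra.Properties.CommutativeSemigroup using (interchange)
open import Data.Nat using (ℕ; zero; suc; _+_; _∸_; _≤_; _<_; _<ᵇ_; z≤n; s≤s; _≤?_; _<?_)
open import Data.Nat.Properties hiding (_≟_; suc-injective)
open import Data.Nat.Properties using () renaming (suc-injective to ℕ-suc-injective)
open import Data.Bool using (Bool; true; false; T; _∧_; _∨_; not; if_then_else_)
open import Data.Bool.Properties using (T-≡; T-∧; T-∨; ∧-comm)
open import Data.Fin using (Fin; zero; suc; toℕ; fromℕ; inject₁; _≟_; fromℕ<)
open import Data.Fin.Properties using (suc-injective; toℕ-injective; toℕ-fromℕ; toℕ-inject₁; toℕ<n; toℕ-fromℕ<; any?) renaming (0≢1+n to zero≢suc)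
open import Data.Product using (_×_; _,_; Σ; ∃; proj₁; proj₂)
open import Data.Sum using (_⊎_; inj₁; inj₂)
open import Data.Empty using (⊥-elim)
open import Data.Unit using (tt)
open import Function.Bundles using (_⇔_; Equivalence)
open import Relation.Nullary using (¬_; yes; no; Dec)
open import Relation.Nullary.Decidable using (⌊_⌋; toWitness; fromWitness)
open import Relation.Binary.PropositionalEquality

∧-fst : ∀ {a b} → T (a ∧ b) → T a
∧-fst {a} {b} t = proj₁ (Equivalence.to (T-∧ {a} {b}) t)

∧-snd : ∀ {a b} → T (a ∧ b) → T b
∧-snd {a} {b} t = proj₂ (Equivalence.to (T-∧ {a} {b}) t)

∧-pair : ∀ {a b} → T a → T b → T (a ∧ b)
∧-pair {a} {b} s t = Equivalence.from (T-∧ {a} {b}) (s , t)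

∨-cases : ∀ {a b} → T (a ∨ b) → T a ⊎ T b
∨-cases {a} {b} = Equivalence.to (T-∨ {a} {b})

∨-inl : ∀ {a b} → T a → T (a ∨ b)
∨-inl {a} {b} t = Equivalence.from (T-∨ {a} {b}) (inj₁ t)

∨-inr : ∀ {a b} → T b → T (a ∨ b)
∨-inr {a} {b} t = Equivalence.from (T-∨ {a} {b}) (inj₂ t)

not-intro : ∀ {a} → ¬ T a → T (not a)
not-intro {true} h = h tt
not-intro {false} _ = tt

not-elim : ∀ {a} → T (not a) → ¬ T a
not-elim {true} ()

T⇒≡true : ∀ {b} → T b → b ≡ true
T⇒≡true {b} = Equivalence.to (T-≡ {b})

bool-ext : ∀ {a b} → (T a → T b) → (T b → T a) → a ≡ b
bool-ext {true} {true} _ _ = refl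
bool-ext {true} {false} f _ = ⊥-elim (f tt)
bool-ext {false} {true} _ g = ⊥-elim (g tt)
bool-ext {false} {false} _ _ = refl

ind : Bool → ℕ
ind b = if b then 1 else 0

ind-T : ∀ {b} → T b → ind b ≡ 1
ind-T {true} _ = refl

ind-F : ∀ {b} → ¬ T b → ind b ≡ 0
ind-F {true} h = ⊥-elim (h tt)
ind-F {false} _ = refl

ind≤1 : ∀ b → ind b ≤ 1
ind≤1 true = ≤-refl
ind≤1 false = z≤n

ind-mono : ∀ {a b} → (T a → T b) → ind a ≤ ind b
ind-mono {false} _ = z≤n
ind-mono {true} {true} _ = ≤-refl
ind-mono {true} {false} h = ⊥-elim (h tt)

ind-∨ : ∀ a b → ind (a ∨ b) ≤ ind a + ind b
ind-∨ true b = s≤s z≤n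
ind-∨ false b = ≤-refl

eqb : ∀ {n} → Fin n → Fin n → Bool
eqb u v = ⌊ u ≟ v ⌋

eqb-sound : ∀ {n} {u v : Fin n} → T (eqb u v) → u ≡ v
eqb-sound {u = u} {v} = toWitness {a? = u ≟ v}

eqb-refl : ∀ {n} (v : Fin n) → T (eqb v v)
eqb-refl v = fromWitness {a? = v ≟ v} refl

eqb-false : ∀ {n} {u v : Fin n} → ¬ u ≡ v → eqb u v ≡ false
eqb-false {u = u} {v} u≢v with u ≟ v
... | yes u≡v = ⊥-elim (u≢v u≡v)
... | no _ = refl

recolour : ∀ {n s} → (Fin n → Fin s) → Fin n → Fin s → Fin n → Fin s
recolour c v i u = if eqb u v then i else c u

recolour-same : ∀ {n s} (c : Fin n → Fin s) v i → recolour c v i v ≡ i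
recolour-same c v i rewrite T⇒≡true (eqb-refl v) = refl

recolour-other : ∀ {n s} (c : Fin n → Fin s) v i u → ¬ u ≡ v → recolour c v i u ≡ c u
recolour-other c v i u u≢v rewrite eqb-false u≢v = refl

sumFin-cong : ∀ {n} {g h : Fin n → ℕ} → (∀ i → g i ≡ h i) → sumFin g ≡ sumFin h
sumFin-cong {zero} _ = refl
sumFin-cong {suc n} e = cong₂ _+_ (e zero) (sumFin-cong (λ i → e (suc i)))

sumFin-mono : ∀ {n} {g h : Fin n → ℕ} → (∀ i → g i ≤ h i) → sumFin g ≤ sumFin h
sumFin-mono {zero} _ = z≤n
sumFin-mono {suc n} le = +-mono-≤ (le zero) (sumFin-mono (λ i → le (suc i)))

sumFin-zero : ∀ n → sumFin {n} (λ _ → 0) ≡ 0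
sumFin-zero zero = refl
sumFin-zero (suc n) = sumFin-zero n

sumFin-+ : ∀ {n} (g h : Fin n → ℕ) → sumFin (λ i → g i + h i) ≡ sumFin g + sumFin h
sumFin-+ {zero} g h = refl
sumFin-+ {suc n} g h = trans
  (cong (g zero + h zero +_) (sumFin-+ (λ i → g (suc i)) (λ i → h (suc i))))
  (interchange +-commutativeSemigroup (g zero) (h zero) _ _)

sumFin-swap : ∀ {m n} (g : Fin m → Fin n → ℕ) →
  sumFin (λ i → sumFin (g i)) ≡ sumFin (λ u → sumFin (λ i → g i u))
sumFin-swap {zero} {n} g = sym (sumFin-zero n)
sumFin-swap {suc m} g = trans
  (cong (sumFin (g zero) +_) (sumFin-swap (λ i → g (suc i))))
  (sym (sumFin-+ (g zero) (λ u → sumFin (λ i → g (suc i) u))))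

sumFin-term : ∀ {n} (g : Fin n → ℕ) u → g u ≤ sumFin g
sumFin-term g zero = m≤m+n _ _
sumFin-term g (suc u) = ≤-trans (sumFin-term (λ i → g (suc i)) u) (m≤n+m _ _)

pigeonhole : ∀ {n} (g h : Fin n → ℕ) → sumFin g < sumFin h → ∃ λ i → g i < h i
pigeonhole {zero} g h ()
pigeonhole {suc n} g h lt with g zero <? h zero
... | yes here = zero , here
... | no ¬here with sumFin (λ i → g (suc i)) <? sumFin (λ i → h (suc i))
...   | yes rest = let (i , gi<hi) = pigeonhole _ _ rest in suc i , gi<hi
...   | no ¬rest = ⊥-elim (<-irrefl refl (<-≤-trans lt (+-mono-≤ (≮⇒≥ ¬here) (≮⇒≥ ¬rest))))

count≡sum : ∀ {n} (P : Fin n → Bool) → countFin P ≡ sumFin (λ u → ind (P u))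
count≡sum {zero} P = refl
count≡sum {suc n} P = cong (ind (P zero) +_) (count≡sum (λ i → P (suc i)))

count-cong : ∀ {n} {P Q : Fin n → Bool} → (∀ u → P u ≡ Q u) → countFin P ≡ countFin Q
count-cong {zero} _ = refl
count-cong {suc n} e = cong₂ _+_ (cong ind (e zero)) (count-cong (λ i → e (suc i)))

count-mono : ∀ {n} {P Q : Fin n → Bool} → (∀ u → T (P u) → T (Q u)) → countFin P ≤ countFin Q
count-mono {zero} _ = z≤n
count-mono {suc n} P⇒Q = +-mono-≤ (ind-mono (P⇒Q zero)) (count-mono (λ i → P⇒Q (suc i)))

count-none : ∀ {n} {P : Fin n → Bool} → (∀ u → ¬ T (P u)) → countFin P ≡ 0
count-none {zero} _ = refl
count-none {suc n} ¬P = cong₂ _+_ (ind-F (¬P zero)) (count-none (λ i → ¬P (suc i)))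

count-∨ : ∀ {n} (P Q : Fin n → Bool) → countFin (λ u → P u ∨ Q u) ≤ countFin P + countFin Q
count-∨ {zero} P Q = z≤n
count-∨ {suc n} P Q = ≤-trans
  (+-mono-≤ (ind-∨ (P zero) (Q zero)) (count-∨ (λ i → P (suc i)) (λ i → Q (suc i))))
  (≤-reflexive (interchange +-commutativeSemigroup (ind (P zero)) (ind (Q zero)) _ _))

count-split : ∀ {n} (P Q : Fin n → Bool) →
  countFin P ≡ countFin (λ u → P u ∧ Q u) + countFin (λ u → P u ∧ not (Q u))
count-split {zero} P Q = refl
count-split {suc n} P Q = trans
  (cong₂ _+_ (split-ind (P zero) (Q zero)) (count-split (λ i → P (suc i)) (λ i → Q (suc i))))
  (interchange +-commutativeSemigroup (ind (P zero ∧ Q zero)) (ind (P zero ∧ not (Q zero))) _ _)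
  where
    split-ind : ∀ a b → ind a ≡ ind (a ∧ b) + ind (a ∧ not b)
    split-ind true true = refl
    split-ind true false = refl
    split-ind false b = refl

count-pos : ∀ {n} (Q : Fin n → Bool) v → T (Q v) → 1 ≤ countFin Q
count-pos Q zero t = ≤-trans (≤-reflexive (sym (ind-T t))) (m≤m+n _ _)
count-pos Q (suc v) t = ≤-trans (count-pos (λ i → Q (suc i)) v t) (m≤n+m _ _)

count-unique : ∀ {n} (P : Fin n → Bool) → (∀ u u′ → T (P u) → T (P u′) → u ≡ u′) → countFin P ≤ 1
count-unique {zero} P _ = z≤n
count-unique {suc n} P uniq with P zero in e
... | true = ≤-reflexive (cong suc (count-none (λ i t → zero≢suc (uniq zero (suc i) (subst T (sym e) tt) t))))
... | false = count-unique (λ i → P (suc i)) (λ u u′ t t′ → suc-injective (uniq (suc u) (suc u′) t t′))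

count-point : ∀ {n} (P : Fin n → Bool) v → countFin (λ u → P u ∧ eqb u v) ≡ ind (P v)
count-point P v with P v in e
... | true = ≤-antisym
  (count-unique _ (λ u u′ t t′ → trans (eqb-sound (∧-snd {P u} t)) (sym (eqb-sound (∧-snd {P u′} t′)))))
  (count-pos _ v (∧-pair (subst T (sym e) tt) (eqb-refl v)))
... | false = count-none (λ u t → subst T e (subst (λ w → T (P w)) (eqb-sound (∧-snd {P u} t)) (∧-fst t)))

count-remove : ∀ {n} (P : Fin n → Bool) v →
  countFin P ≡ ind (P v) + countFin (λ u → P u ∧ not (eqb u v))
count-remove P v =
  trans (count-split P (λ u → eqb u v)) (cong (_+ countFin (λ u → P u ∧ not (eqb u v))) (count-point P v))

count-inj : ∀ {m n} (P : Fin m → Bool) (Q : Fin n → Bool) (φ : Fin m → Fin n) →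
  (∀ a b → φ a ≡ φ b → a ≡ b) → (∀ l → T (P l) → T (Q (φ l))) → countFin P ≤ countFin Q
count-inj {zero} P Q φ φ-inj P⇒Q = z≤n
count-inj {suc m} P Q φ φ-inj P⇒Q = begin
    ind (P zero) + countFin (λ i → P (suc i))
  ≤⟨ +-mono-≤ (ind-mono (P⇒Q zero))
      (count-inj _ Q′ (λ i → φ (suc i)) (λ a b e → suc-injective (φ-inj _ _ e)) rest) ⟩
    ind (Q (φ zero)) + countFin Q′
  ≡⟨ count-remove Q (φ zero) ⟨
    countFin Q ∎
  where
    open ≤-Reasoning
    Q′ : Fin _ → Bool
    Q′ u = Q u ∧ not (eqb u (φ zero))
    rest : ∀ l → T (P (suc l)) → T (Q′ (φ (suc l)))
    rest l t = ∧-pair (P⇒Q (suc l) t) (not-intro (λ q → zero≢suc (φ-inj _ _ (sym (eqb-sound q)))))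

anyFin-witness : ∀ {n} (P : Fin n → Bool) → T (anyFin P) → ∃ λ l → T (P l)
anyFin-witness {suc n} P t with ∨-cases {P zero} t
... | inj₁ here = zero , here
... | inj₂ there = let (l , q) = anyFin-witness (λ i → P (suc i)) there in suc l , q

anyFin-intro : ∀ {n} (P : Fin n → Bool) l → T (P l) → T (anyFin P)
anyFin-intro P zero t = ∨-inl t
anyFin-intro P (suc l) t = ∨-inr {P zero} (anyFin-intro (λ i → P (suc i)) l t)

module Colouring {n s} {G : Graph n} (H : Cover G s) (f : Fin n → Fin s → ℕ) where

  hits : (Fin n → Bool) → (Fin n → Fin s) → Fin n → Fin s → ℕ
  hits S c v i = countFin (λ u → S u ∧ hadj H (v , i) (u , c u))

  nbrs : (Fin n → Bool) → Fin n → ℕ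
  nbrs S v = countFin (λ u → S u ∧ adj G v u)

  partners≤1 : ∀ u v j → ¬ u ≡ v → countFin (λ i → hadj H (v , i) (u , j)) ≤ 1
  partners≤1 u v j u≢v = count-unique _ (λ i i′ t t′ →
    matching H u v j i i′ u≢v (subst T (hsym H (v , i) (u , j)) t) (subst T (hsym H (v , i′) (u , j)) t′))

  -- Summed over the colours of v ∉ S, the hits are at most the number of
  -- neighbours of v in S: each neighbour u hits at most one copy of v.
  hits-sum : ∀ S c v → ¬ T (S v) → sumFin (hits S c v) ≤ nbrs S v
  hits-sum S c v v∉S = begin
      sumFin (λ i → countFin (λ u → S u ∧ hadj H (v , i) (u , c u)))
    ≡⟨ sumFin-cong (λ i → count≡sum (λ u → S u ∧ hadj H (v , i) (u , c u))) ⟩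
      sumFin (λ i → sumFin (λ u → ind (S u ∧ hadj H (v , i) (u , c u))))
    ≡⟨ sumFin-swap (λ i u → ind (S u ∧ hadj H (v , i) (u , c u))) ⟩
      sumFin (λ u → sumFin (λ i → ind (S u ∧ hadj H (v , i) (u , c u))))
    ≤⟨ sumFin-mono perVertex ⟩
      sumFin (λ u → ind (S u ∧ adj G v u))
    ≡⟨ count≡sum (λ u → S u ∧ adj G v u) ⟨
      nbrs S v ∎
    where
      open ≤-Reasoning
      perVertex : ∀ u → sumFin (λ i → ind (S u ∧ hadj H (v , i) (u , c u))) ≤ ind (S u ∧ adj G v u)
      perVertex u with S u in u∈S | adj G v u in vu
      ... | false | _ = ≤-reflexive (sumFin-zero s)
      ... | true | false = ≤-reflexive (trans (sym (count≡sum (λ i → hadj H (v , i) (u , c u))))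
            (count-none (λ i t → subst T vu (cross H v u i (c u) v≢u t))))
        where
          v≢u : ¬ v ≡ u
          v≢u refl = v∉S (subst T (sym u∈S) tt)
      ... | true | true = subst (_≤ 1) (count≡sum (λ i → hadj H (v , i) (u , c u)))
            (partners≤1 u v (c u) (λ { refl → v∉S (subst T (sym u∈S) tt) }))

  insert : (Fin n → Bool) → Fin n → Fin n → Bool
  insert S v u = S u ∨ eqb u v

  nbrs≤deg : ∀ S v → nbrs S v ≤ deg G v
  nbrs≤deg S v = count-mono (λ u → ∧-snd {S u})

  nbrs-insert : ∀ S v w → ¬ T (S w) → T (adj G v w) → suc (nbrs S v) ≤ nbrs (insert S w) v
  nbrs-insert S v w w∉S vw = begin
      1 + nbrs S v
    ≤⟨ +-mono-≤ (≤-reflexive (sym (ind-T (∧-pair (∨-inr {S w} (eqb-refl w)) vw)))) (count-mono old) ⟩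
      ind (P w) + countFin (λ u → P u ∧ not (eqb u w))
    ≡⟨ count-remove P w ⟨
      nbrs (insert S w) v ∎
    where
      open ≤-Reasoning
      P : Fin n → Bool
      P u = insert S w u ∧ adj G v u
      old : ∀ u → T (S u ∧ adj G v u) → T (P u ∧ not (eqb u w))
      old u t = ∧-pair (∧-pair (∨-inl {S u} (∧-fst t)) (∧-snd {S u} t))
                       (not-intro (λ q → w∉S (subst (λ z → T (S z)) (eqb-sound q) (∧-fst {S u} t))))

  freeColour : ∀ S c v → ¬ T (S v) → (e : Fin s → ℕ) → nbrs S v + sumFin e < size f v →
               ∃ λ i → hits S c v i + e i < f v i
  freeColour S c v v∉S e lt = pigeonhole (λ i → hits S c v i + e i) (f v)
    (≤-<-trans (≤-reflexive (sumFin-+ (hits S c v) e)) (≤-<-trans (+-monoˡ-≤ (sumFin e) (hits-sum S c v v∉S)) lt))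

  dodge : ∀ u w i j₁ j₂ → ¬ u ≡ w → ¬ j₁ ≡ j₂ →
          ∃ λ j → (j ≡ j₁ ⊎ j ≡ j₂) × ¬ T (hadj H (u , i) (w , j))
  dodge u w i j₁ j₂ u≢w j₁≢j₂ with hadj H (u , i) (w , j₁) in e
  ... | false = j₁ , inj₁ refl , subst T e
  ... | true = j₂ , inj₂ refl , λ t → j₁≢j₂ (matching H u w i j₁ j₂ u≢w (subst T (sym e) tt) t)

  module Ranked (R : Fin n → ℕ) where

    earlier : (Fin n → Bool) → (Fin n → Fin s) → Fin n → Fin s → ℕ
    earlier S c v i = countFin (λ u → S u ∧ (R u <ᵇ R v) ∧ hadj H (v , i) (u , c u))

    -- c is a valid colouring of S in which each vertex v keeps ε v spare units.
    Valid : (Fin n → Bool) → (Fin n → Fin s) → (Fin n → ℕ) → Set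
    Valid S c ε = ∀ v → T (S v) → earlier S c v (c v) + ε v < f v (c v)

    earlier≤hits : ∀ S c v i → earlier S c v i ≤ hits S c v i
    earlier≤hits S c v i = count-mono (λ u t → ∧-pair (∧-fst {S u} t) (∧-snd {R u <ᵇ R v} (∧-snd {S u} t)))

    Valid-cong : ∀ {S S′} c ε → (∀ u → S u ≡ S′ u) → Valid S c ε → Valid S′ c ε
    Valid-cong {S} c ε S≡S′ valid v v∈S′ =
      subst (λ z → z + ε v < f v (c v))
        (count-cong (λ u → cong (λ b → b ∧ (R u <ᵇ R v) ∧ hadj H (v , c v) (u , c u)) (S≡S′ u)))
        (valid v (subst T (sym (S≡S′ v)) v∈S′))

    toDP : (∀ u v → R u ≡ R v → u ≡ v) → ∀ c ε → Valid allTrue c ε → IsDPFColoring G H f allTrue c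
    toDP R-inj c ε valid = R , (λ u v _ _ → R-inj u v) , λ v _ → ≤-<-trans (m≤m+n _ (ε v)) (valid v tt)

    private
      irreflᵇ : ∀ x → ¬ T (x <ᵇ x)
      irreflᵇ x t = <-irrefl refl (<ᵇ⇒< x x t)

    earlier-added : ∀ S c v i → earlier (insert S v) (recolour c v i) v i ≤ earlier S c v i
    earlier-added S c v i = count-mono keep
      where
        keep : ∀ u → T (insert S v u ∧ (R u <ᵇ R v) ∧ hadj H (v , i) (u , recolour c v i u)) →
               T (S u ∧ (R u <ᵇ R v) ∧ hadj H (v , i) (u , c u))
        keep u t with u ≟ v
        ... | yes refl = ⊥-elim (irreflᵇ (R u) (∧-fst (∧-snd {S u ∨ true} t)))
        ... | no u≢v with ∨-cases {S u} (∧-fst t)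
        ...   | inj₂ ()
        ...   | inj₁ u∈S = ∧-pair u∈S (∧-snd {S u ∨ false} t)

    earlier-old : ∀ S c v i w → ¬ w ≡ v →
      earlier (insert S v) (recolour c v i) w (c w)
        ≤ ind ((R v <ᵇ R w) ∧ hadj H (w , c w) (v , i)) + earlier S c w (c w)
    earlier-old S c v i w w≢v = begin
        countFin P
      ≡⟨ count-remove P v ⟩
        ind (P v) + countFin (λ u → P u ∧ not (eqb u v))
      ≤⟨ +-mono-≤ (ind-mono atV) (count-mono elsewhere) ⟩
        ind ((R v <ᵇ R w) ∧ hadj H (w , c w) (v , i)) + earlier S c w (c w) ∎
      where
        open ≤-Reasoning
        P : Fin n → Bool
        P u = insert S v u ∧ (R u <ᵇ R w) ∧ hadj H (w , c w) (u , recolour c v i u)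
        atV : T (P v) → T ((R v <ᵇ R w) ∧ hadj H (w , c w) (v , i))
        atV t = subst (λ z → T ((R v <ᵇ R w) ∧ hadj H (w , c w) (v , z)))
          (recolour-same c v i) (∧-snd {insert S v v} t)
        elsewhere : ∀ u → T (P u ∧ not (eqb u v)) → T (S u ∧ (R u <ᵇ R w) ∧ hadj H (w , c w) (u , c u))
        elsewhere u t with ∨-cases {S u} (∧-fst (∧-fst {P u} t))
        ... | inj₂ u≡v = ⊥-elim (not-elim (∧-snd {P u} t) u≡v)
        ... | inj₁ u∈S = ∧-pair u∈S (subst (λ z → T ((R u <ᵇ R w) ∧ hadj H (w , c w) (u , z)))
              (recolour-other c v i u (λ u≡v → not-elim (∧-snd {P u} t) (subst (λ z → T (eqb u z)) u≡v (eqb-refl u))))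
              (∧-snd {insert S v u} (∧-fst {P u} t)))

    addVertex : ∀ S c ε ε′ v i → Valid S c ε → ¬ T (S v) →
      earlier S c v i + ε′ v < f v i →
      (∀ w → T (S w) → ε′ w + ind ((R v <ᵇ R w) ∧ hadj H (w , c w) (v , i)) ≤ ε w) →
      Valid (insert S v) (recolour c v i) ε′
    addVertex S c ε ε′ v i valid v∉S vOK absorb w w∈S′ with ∨-cases {S w} w∈S′
    ... | inj₂ w≡v with eqb-sound {u = w} {v} w≡v
    ...   | refl = subst (λ z → earlier (insert S w) (recolour c w i) w z + ε′ w < f w z) (sym (recolour-same c w i))
                     (≤-<-trans (+-monoˡ-≤ (ε′ w) (earlier-added S c w i)) vOK)
    addVertex S c ε ε′ v i valid v∉S vOK absorb w w∈S′ | inj₁ w∈S =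
      subst (λ z → earlier (insert S v) (recolour c v i) w z + ε′ w < f w z) (sym (recolour-other c v i w w≢v))
        (begin-strict
          earlier (insert S v) (recolour c v i) w (c w) + ε′ w
        ≤⟨ +-monoˡ-≤ (ε′ w) (earlier-old S c v i w w≢v) ⟩
          (new + earlier S c w (c w)) + ε′ w
        ≡⟨ trans (cong (_+ ε′ w) (+-comm new _)) (trans (+-assoc (earlier S c w (c w)) new (ε′ w)) (cong (earlier S c w (c w) +_) (+-comm new (ε′ w)))) ⟩
          earlier S c w (c w) + (ε′ w + new)
        ≤⟨ +-monoʳ-≤ (earlier S c w (c w)) (absorb w w∈S) ⟩
          earlier S c w (c w) + ε w
        <⟨ valid w w∈S ⟩
          f w (c w) ∎)
      where
        open ≤-Reasoning
        new : ℕ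
        new = ind ((R v <ᵇ R w) ∧ hadj H (w , c w) (v , i))
        w≢v : ¬ w ≡ v
        w≢v refl = v∉S w∈S

module Extension {n s : ℕ} (k : ℕ) (k≥3 : 3 ≤ k)
  (G : Graph n) (H : Cover G s) (f : Fin n → Fin s → ℕ) (f≤2 : ∀ v i → f v i ≤ 2)
  (p : ℕ) (K : Subgraph G (suc (suc p)))
  (cond-i : 3 ≤ k ∸ (deg G (vert K zero) ∸ degK K zero))
  (deg-vₘ : deg G (vert K (fromℕ (suc p))) ≤ k)
  (nbrs-vₘ : ∀ j → Edge G (vert K (fromℕ (suc p))) (vert K j) ⇔ (j ≡ zero ⊎ j ≡ inject₁ (fromℕ p)))
  (cond-iii : ∀ (j : Fin (suc (suc p))) → 1 ≤ toℕ j → toℕ j ≤ p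
         → countFin (λ u → adj G (vert K j) u ∧ earlierOrOutside K j u) ≤ k ∸ 1)
  (|f|≥k : ∀ v → k ≤ size f v)
  (c′ : Fin n → Fin s) (r′ : Fin n → ℕ)
  (r′-inj : ∀ u v → T (outsideK K u) → T (outsideK K v) → r′ u ≡ r′ v → u ≡ v)
  (r′-ok : ∀ v → T (outsideK K v) → precNbrs H (outsideK K) c′ r′ v < f v (c′ v))
  where

  open Colouring H f

  m : ℕ
  m = suc (suc p)

  V : Fin m → Fin n
  V = vert K

  -- 0-based indices of v_m and v_{m−1} in K (m = p + 2).
  lastI prevI : Fin m
  lastI = fromℕ (suc p)
  prevI = inject₁ (fromℕ p)

  v₁ vₘ vₘ₋₁ : Fin n
  v₁ = V zero
  vₘ = V lastI
  vₘ₋₁ = V prevI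

  toℕ-lastI : toℕ lastI ≡ suc p
  toℕ-lastI = toℕ-fromℕ (suc p)

  toℕ-prevI : toℕ prevI ≡ p
  toℕ-prevI = trans (toℕ-inject₁ (fromℕ p)) (toℕ-fromℕ p)

  V-inj : ∀ {a b} → V a ≡ V b → a ≡ b
  V-inj {a} {b} = vinj K a b

  V-inj-toℕ : ∀ {a b} → V a ≡ V b → toℕ a ≡ toℕ b
  V-inj-toℕ e = cong toℕ (V-inj e)

  Out : Fin n → Bool
  Out = outsideK K

  Result : Set
  Result = Σ (Fin n → Fin s) λ c → IsDPFColoring G H f allTrue c × (∀ v → T (Out v) → c v ≡ c′ v)

  locate : ∀ u → (Σ (Fin m) λ l → V l ≡ u) ⊎ T (Out u)
  locate u with anyFin (λ l → eqb (V l) u) in e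
  ... | true = let (l , t) = anyFin-witness (λ l → eqb (V l) u) (subst T (sym e) tt) in inj₁ (l , eqb-sound t)
  ... | false = inj₂ tt

  V∉Out : ∀ l → ¬ T (Out (V l))
  V∉Out l o = not-elim o (anyFin-intro (λ l′ → eqb (V l′) (V l)) l (eqb-refl (V l)))

  -- Coloured t: the vertices outside K together with the first t vertices of K.
  Coloured : ℕ → Fin n → Bool
  Coloured t u = Out u ∨ anyFin (λ l → (toℕ l <ᵇ t) ∧ eqb (V l) u)

  Coloured-cases : ∀ t u → T (Coloured t u) → T (Out u) ⊎ (Σ (Fin m) λ l → toℕ l < t × V l ≡ u)
  Coloured-cases t u c with ∨-cases {Out u} c
  ... | inj₁ o = inj₁ o
  ... | inj₂ a = let (l , q) = anyFin-witness (λ l → (toℕ l <ᵇ t) ∧ eqb (V l) u) a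
                 in inj₂ (l , <ᵇ⇒< _ _ (∧-fst q) , eqb-sound (∧-snd {toℕ l <ᵇ t} q))

  Coloured-out : ∀ t u → T (Out u) → T (Coloured t u)
  Coloured-out t u = ∨-inl

  Coloured-K : ∀ t l → toℕ l < t → T (Coloured t (V l))
  Coloured-K t l lt = ∨-inr {Out (V l)}
    (anyFin-intro (λ l′ → (toℕ l′ <ᵇ t) ∧ eqb (V l′) (V l)) l (∧-pair (<⇒<ᵇ lt) (eqb-refl (V l))))

  Coloured-fresh : ∀ t l → t ≤ toℕ l → ¬ T (Coloured t (V l))
  Coloured-fresh t l t≤l c with Coloured-cases t (V l) c
  ... | inj₁ o = V∉Out l o
  ... | inj₂ (l′ , l′<t , e) = <-irrefl (V-inj-toℕ e) (<-≤-trans l′<t t≤l)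

  Coloured-suc : ∀ t l → toℕ l ≡ t → ∀ u → Coloured (suc t) u ≡ insert (Coloured t) (V l) u
  Coloured-suc t l refl u = bool-ext forward backward
    where
      forward : T (Coloured (suc t) u) → T (insert (Coloured t) (V l) u)
      forward c with Coloured-cases (suc t) u c
      ... | inj₁ o = ∨-inl (Coloured-out t u o)
      ... | inj₂ (l′ , l′<1+t , refl) with toℕ l′ <? t
      ...   | yes l′<t = ∨-inl (Coloured-K t l′ l′<t)
      ...   | no l′≮t = ∨-inr {Coloured t (V l′)}
              (subst (λ z → T (eqb (V l′) (V z))) (toℕ-injective (≤-antisym (≤-pred l′<1+t) (≮⇒≥ l′≮t))) (eqb-refl (V l′)))
      backward : T (insert (Coloured t) (V l) u) → T (Coloured (suc t) u)
      backward c with ∨-cases {Coloured t u} c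
      ... | inj₂ q with eqb-sound {u = u} {V l} q
      ...   | refl = Coloured-K (suc t) l ≤-refl
      backward c | inj₁ c′ with Coloured-cases t u c′
      ... | inj₁ o = Coloured-out (suc t) u o
      ... | inj₂ (l′ , l′<t , refl) = Coloured-K (suc t) l′ (m<n⇒m<1+n l′<t)

  Coloured-zero : ∀ u → Coloured 0 u ≡ Out u
  Coloured-zero u = bool-ext outside (Coloured-out 0 u)
    where
      outside : T (Coloured 0 u) → T (Out u)
      outside c with Coloured-cases 0 u c
      ... | inj₁ o = o
      ... | inj₂ (_ , () , _)

  Coloured-all : ∀ u → insert (Coloured (suc p)) vₘ u ≡ true
  Coloured-all u with locate u
  ... | inj₂ o = T⇒≡true (∨-inl (Coloured-out (suc p) u o))
  ... | inj₁ (l , refl) with toℕ l <? suc p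
  ...   | yes l<m-1 = T⇒≡true (∨-inl (Coloured-K (suc p) l l<m-1))
  ...   | no l≮m-1 = T⇒≡true (∨-inr {Coloured (suc p) (V l)}
          (subst (λ z → T (eqb (V l) (V z))) (toℕ-injective (trans last≡ (sym toℕ-lastI))) (eqb-refl (V l))))
    where
      last≡ : toℕ l ≡ suc p
      last≡ = ≤-antisym (≤-pred (toℕ<n l)) (≮⇒≥ l≮m-1)

  -- Ranks.  Vertices outside K keep their ranks r′; the vertices of K come
  -- after all of them in the order v_1, …, v_m, except that when vₘFirst holds
  -- v_m is moved in front of v_1.
  base : ℕ
  base = suc (sumFin r′)

  r′<base : ∀ u → r′ u < base
  r′<base u = s≤s (sumFin-term r′ u)

  -- Position of v_l among the vertices of K (0 is reserved for a moved v_m).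
  posK : Bool → Fin m → ℕ
  posK vₘFirst l = if vₘFirst ∧ eqb l lastI then 0 else suc (toℕ l)

  posK-moved : ∀ b l → T (b ∧ eqb l lastI) → posK b l ≡ 0
  posK-moved b l t rewrite T⇒≡true t = refl

  posK-regular : ∀ b l → ¬ T (b ∧ eqb l lastI) → posK b l ≡ suc (toℕ l)
  posK-regular b l ¬t with b ∧ eqb l lastI
  ... | true = ⊥-elim (¬t tt)
  ... | false = refl

  unmoved : ∀ b l → ¬ l ≡ lastI → ¬ T (b ∧ eqb l lastI)
  unmoved b l l≢last t = l≢last (eqb-sound (∧-snd {b} t))

  posK≤ : ∀ b l → posK b l ≤ suc (toℕ l)
  posK≤ b l with b ∧ eqb l lastI
  ... | true = z≤n
  ... | false = ≤-refl

  posK-inj : ∀ b l l′ → posK b l ≡ posK b l′ → l ≡ l′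
  posK-inj b l l′ e with b ∧ eqb l lastI in el | b ∧ eqb l′ lastI in el′
  ... | true | true = trans (eqb-sound (∧-snd {b} (subst T (sym el) tt))) (sym (eqb-sound (∧-snd {b} (subst T (sym el′) tt))))
  ... | false | false = toℕ-injective (ℕ-suc-injective e)

  rankOf : Bool → ∀ u → (Σ (Fin m) λ l → V l ≡ u) ⊎ T (Out u) → ℕ
  rankOf b u (inj₁ (l , _)) = base + posK b l
  rankOf b u (inj₂ _) = r′ u

  rank : Bool → Fin n → ℕ
  rank b u = rankOf b u (locate u)

  rank-K : ∀ b l → rank b (V l) ≡ base + posK b l
  rank-K b l = atV (locate (V l))
    where
      atV : ∀ loc → rankOf b (V l) loc ≡ base + posK b l
      atV (inj₁ (l′ , e)) = cong (λ z → base + posK b z) (V-inj e)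
      atV (inj₂ o) = ⊥-elim (V∉Out l o)

  rank-out : ∀ b u → T (Out u) → rank b u ≡ r′ u
  rank-out b u o = outside (locate u)
    where
      outside : ∀ loc → rankOf b u loc ≡ r′ u
      outside (inj₁ (l , refl)) = ⊥-elim (V∉Out l o)
      outside (inj₂ _) = refl

  rank-inj : ∀ b u v → rank b u ≡ rank b v → u ≡ v
  rank-inj b u v = compare (locate u) (locate v)
    where
      compare : ∀ x y → rankOf b u x ≡ rankOf b v y → u ≡ v
      compare (inj₁ (l , refl)) (inj₁ (l′ , refl)) e = cong V (posK-inj b l l′ (+-cancelˡ-≡ base _ _ e))
      compare (inj₁ (l , refl)) (inj₂ o) e = ⊥-elim (<-irrefl (sym e) (<-≤-trans (r′<base v) (m≤m+n base _)))
      compare (inj₂ o) (inj₁ (l , refl)) e = ⊥-elim (<-irrefl e (<-≤-trans (r′<base u) (m≤m+n base _)))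
      compare (inj₂ o) (inj₂ o′) e = r′-inj u v o o′ e

  rank-out<K : ∀ b u l → T (Out u) → rank b u < rank b (V l)
  rank-out<K b u l o rewrite rank-out b u o | rank-K b l = <-≤-trans (r′<base u) (m≤m+n base _)

  rank-below : ∀ b t l w → ¬ T (b ∧ eqb l lastI) → t ≤ toℕ l → T (Coloured t w) → rank b w < rank b (V l)
  rank-below b t l w unmoved t≤l c with Coloured-cases t w c
  ... | inj₁ o = rank-out<K b w l o
  ... | inj₂ (l′ , l′<t , refl) rewrite rank-K b l′ | rank-K b l | posK-regular b l unmoved =
    +-monoʳ-< base (≤-<-trans (posK≤ b l′) (s≤s (<-≤-trans l′<t t≤l)))

  -- Colouring v_1, v_2, …, v_{m−1} in this order, for either ranking.  When
  -- v_m is ranked first it may later become an earlier neighbour of v_1, so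
  -- v_1 keeps one unit of slack.
  module Order (vₘFirst : Bool) where
    open Ranked (rank vₘFirst) public

    slack : Fin n → ℕ
    slack u = ind (vₘFirst ∧ eqb u v₁)

    slack-other : ∀ u → ¬ u ≡ v₁ → slack u ≡ 0
    slack-other u u≢v₁ = ind-F (λ t → u≢v₁ (eqb-sound (∧-snd {vₘFirst} t)))

    slack-out : ∀ u → T (Out u) → slack u ≡ 0
    slack-out u o = slack-other u (λ { refl → V∉Out zero o })

    record Partial (t : ℕ) (i₁ : Fin s) : Set where
      field
        col : Fin n → Fin s
        valid : Valid (Coloured t) col slack
        extends : ∀ u → T (Out u) → col u ≡ c′ u
        atV₁ : col v₁ ≡ i₁
    open Partial public

    start : Valid (Coloured 0) c′ slack
    start v c = subst₂ (λ a b → a + b < f v (c′ v)) (sym (count-cong same)) (sym (slack-out v o))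
      (subst (_< f v (c′ v)) (sym (+-identityʳ _)) (r′-ok v o))
      where
        o : T (Out v)
        o = subst T (Coloured-zero v) c
        same : ∀ u → (Coloured 0 u ∧ (rank vₘFirst u <ᵇ rank vₘFirst v) ∧ hadj H (v , c′ v) (u , c′ u))
                   ≡ (Out u ∧ (r′ u <ᵇ r′ v) ∧ hadj H (v , c′ v) (u , c′ u))
        same u rewrite Coloured-zero u with Out u in ou
        ... | false = refl
        ... | true rewrite rank-out vₘFirst u (subst T (sym ou) tt) | rank-out vₘFirst v o = refl

    -- Adding an unmoved v_l at stage t = l: it ranks above everything coloured
    -- so far, so it is nobody's earlier neighbour.
    addNext : ∀ t l c i → toℕ l ≡ t → ¬ T (vₘFirst ∧ eqb l lastI) → Valid (Coloured t) c slack →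
              hits (Coloured t) c (V l) i + slack (V l) < f (V l) i →
              Valid (insert (Coloured t) (V l)) (recolour c (V l) i) slack
    addNext t l c i refl unmov valid room =
      addVertex (Coloured t) c slack slack (V l) i valid (Coloured-fresh t l ≤-refl)
        (≤-<-trans (+-monoˡ-≤ (slack (V l)) (earlier≤hits (Coloured t) c (V l) i)) room)
        (λ w c → ≤-reflexive (trans (cong (slack w +_) (notAfter w c)) (+-identityʳ (slack w))))
      where
        notAfter : ∀ w → T (Coloured t w) →
                   ind ((rank vₘFirst (V l) <ᵇ rank vₘFirst w) ∧ hadj H (w , c w) (V l , i)) ≡ 0
        notAfter w c = ind-F (λ q → <-asym (rank-below vₘFirst t l w unmov ≤-refl c)
                                           (<ᵇ⇒< _ _ (∧-fst q)))

    colourV₁ : ∀ i₁ → hits Out c′ v₁ i₁ + slack v₁ < f v₁ i₁ → Partial 1 i₁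
    colourV₁ i₁ room = record
      { col = recolour c′ v₁ i₁
      ; valid = Valid-cong _ slack (λ u → sym (Coloured-suc 0 zero refl u))
          (addNext 0 zero c′ i₁ refl (unmoved vₘFirst zero (λ ())) start
            (subst (λ z → z + slack v₁ < f v₁ i₁) (count-cong (λ u → cong (_∧ hadj H (v₁ , i₁) (u , c′ u)) (sym (Coloured-zero u)))) room))
      ; extends = λ u o → recolour-other c′ v₁ i₁ u (λ { refl → V∉Out zero o })
      ; atV₁ = recolour-same c′ v₁ i₁ }

    nbrs-middle : ∀ l → 1 ≤ toℕ l → toℕ l ≤ p → nbrs (Coloured (toℕ l)) (V l) ≤ k ∸ 1
    nbrs-middle l 1≤l l≤p =
      subst (_≤ k ∸ 1) (count-cong (λ u → ∧-comm (adj G (V l) u) (Coloured (toℕ l) u))) (cond-iii l 1≤l l≤p)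

    greedyStep : ∀ i₁ t (l : Fin m) → toℕ l ≡ t → 1 ≤ t → t ≤ p → Partial t i₁ → Partial (suc t) i₁
    greedyStep i₁ t l refl 1≤l l≤p st = record
      { col = recolour (col st) (V l) i
      ; valid = Valid-cong _ slack (λ u → sym (Coloured-suc t l refl u))
          (addNext t l (col st) i refl (unmoved vₘFirst l l≢last) (valid st)
            (subst (λ z → hits (Coloured t) (col st) (V l) i + z < f (V l) i) (sym (slack-other (V l) Vl≢v₁)) room))
      ; extends = λ u o → trans (recolour-other (col st) (V l) i u (λ { refl → V∉Out l o })) (extends st u o)
      ; atV₁ = trans (recolour-other (col st) (V l) i v₁ (λ e → Vl≢v₁ (sym e))) (atV₁ st) }
      where
        l≢last : ¬ l ≡ lastI
        l≢last e = <-irrefl (trans (cong toℕ e) toℕ-lastI) (s≤s l≤p)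
        Vl≢v₁ : ¬ V l ≡ v₁
        Vl≢v₁ e = <-irrefl (sym (V-inj-toℕ e)) 1≤l
        fewNbrs : nbrs (Coloured t) (V l) + sumFin {s} (λ _ → 0) < size f (V l)
        fewNbrs = begin-strict
            nbrs (Coloured t) (V l) + sumFin {s} (λ _ → 0)
          ≡⟨ cong (nbrs (Coloured t) (V l) +_) (sumFin-zero s) ⟩
            nbrs (Coloured t) (V l) + 0
          ≡⟨ +-identityʳ _ ⟩
            nbrs (Coloured t) (V l)
          ≤⟨ nbrs-middle l 1≤l l≤p ⟩
            k ∸ 1
          <⟨ ∸-monoʳ-< {k} {1} {0} (s≤s z≤n) (≤-trans (s≤s z≤n) k≥3) ⟩
            k ∸ 0
          ≤⟨ |f|≥k (V l) ⟩
            size f (V l) ∎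
          where open ≤-Reasoning
        free = freeColour (Coloured t) (col st) (V l) (Coloured-fresh t l ≤-refl) (λ _ → 0) fewNbrs
        i : Fin s
        i = proj₁ free
        room : hits (Coloured t) (col st) (V l) i + 0 < f (V l) i
        room = proj₂ free

    colourUpTo : ∀ i₁ → Partial 1 i₁ → ∀ t → t ≤ p → Partial (suc t) i₁
    colourUpTo i₁ st zero _ = st
    colourUpTo i₁ st (suc t) t<p =
      greedyStep i₁ (suc t) (fromℕ< lt) (toℕ-fromℕ< lt) (s≤s z≤n) t<p
        (colourUpTo i₁ st t (≤-trans (n≤1+n t) t<p))
      where
        lt : suc t < m
        lt = s≤s (m≤n⇒m≤1+n t<p)

    colourAllButLast : ∀ i₁ → hits Out c′ v₁ i₁ + slack v₁ < f v₁ i₁ → Partial (suc p) i₁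
    colourAllButLast i₁ room = colourUpTo i₁ (colourV₁ i₁ room) p ≤-refl

    finish : ∀ c ε → Valid (insert (Coloured (suc p)) vₘ) c ε → IsDPFColoring G H f allTrue c
    finish c ε valid = toDP (rank-inj vₘFirst) c ε (Valid-cong c ε Coloured-all valid)

  module Last = Order false
  module First = Order true

  a : Fin s → ℕ
  a j = hits Out c′ vₘ j

  vₘ-fresh : ¬ T (Coloured (suc p) vₘ)
  vₘ-fresh = Coloured-fresh (suc p) lastI (≤-reflexive (sym toℕ-lastI))

  K-nbr-vₘ : ∀ l → Edge G vₘ (V l) → l ≡ zero ⊎ l ≡ prevI
  K-nbr-vₘ l = Equivalence.to (nbrs-vₘ l)

  edge-to-vₘ : ∀ w i j → T (Coloured (suc p) w) → T (hadj H (vₘ , j) (w , i)) → Edge G vₘ w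
  edge-to-vₘ w i j c h = cross H vₘ w j i (λ { refl → vₘ-fresh c }) h

  lastHits : ∀ c j → (∀ u → T (Out u) → c u ≡ c′ u) →
    hits (Coloured (suc p)) c vₘ j ≤ a j + (ind (hadj H (vₘ , j) (v₁ , c v₁)) + ind (hadj H (vₘ , j) (vₘ₋₁ , c vₘ₋₁)))
  lastHits c j extends = begin
      countFin P
    ≤⟨ count-mono classify ⟩
      countFin (λ u → Q₁ u ∨ (Q₂ u ∨ Q₃ u))
    ≤⟨ count-∨ Q₁ (λ u → Q₂ u ∨ Q₃ u) ⟩
      countFin Q₁ + countFin (λ u → Q₂ u ∨ Q₃ u)
    ≤⟨ +-monoʳ-≤ (countFin Q₁) (count-∨ Q₂ Q₃) ⟩
      a j + (countFin Q₂ + countFin Q₃)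
    ≡⟨ cong (a j +_) (cong₂ _+_ (count-point hit v₁) (count-point hit vₘ₋₁)) ⟩
      a j + (ind (hit v₁) + ind (hit vₘ₋₁)) ∎
    where
      open ≤-Reasoning
      hit P Q₁ Q₂ Q₃ : Fin n → Bool
      hit u = hadj H (vₘ , j) (u , c u)
      P u = Coloured (suc p) u ∧ hit u
      Q₁ u = Out u ∧ hadj H (vₘ , j) (u , c′ u)
      Q₂ u = hit u ∧ eqb u v₁
      Q₃ u = hit u ∧ eqb u vₘ₋₁
      classifyAt : ∀ u → T (P u) → (Σ (Fin m) λ l → V l ≡ u) ⊎ T (Out u) → T (Q₁ u ∨ (Q₂ u ∨ Q₃ u))
      classifyAt u t (inj₂ o) = ∨-inl (∧-pair o (subst (λ z → T (hadj H (vₘ , j) (u , z))) (extends u o) (∧-snd {Coloured (suc p) u} t)))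
      classifyAt u t (inj₁ (l , refl)) with K-nbr-vₘ l (edge-to-vₘ (V l) (c (V l)) j (∧-fst t) (∧-snd {Coloured (suc p) (V l)} t))
      ... | inj₁ refl = ∨-inr {Q₁ v₁} (∨-inl (∧-pair (∧-snd {Coloured (suc p) v₁} t) (eqb-refl v₁)))
      ... | inj₂ refl = ∨-inr {Q₁ vₘ₋₁} (∨-inr {Q₂ vₘ₋₁} (∧-pair (∧-snd {Coloured (suc p) vₘ₋₁} t) (eqb-refl vₘ₋₁)))
      classify : ∀ u → T (P u) → T (Q₁ u ∨ (Q₂ u ∨ Q₃ u))
      classify u t = classifyAt u t (locate u)

  finishLast : ∀ {i₁} (st : Last.Partial (suc p) i₁) j →
    a j + (ind (hadj H (vₘ , j) (v₁ , i₁)) + ind (hadj H (vₘ , j) (vₘ₋₁ , Last.col st vₘ₋₁))) < f vₘ j → Result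
  finishLast {i₁} st j room = recolour c vₘ j , Last.finish (recolour c vₘ j) Last.slack valid , agrees
    where
      c = Last.col st
      valid : Last.Valid (insert (Coloured (suc p)) vₘ) (recolour c vₘ j) Last.slack
      valid = Last.addNext (suc p) lastI c j toℕ-lastI (λ ()) (Last.valid st)
        (≤-<-trans (≤-reflexive (+-identityʳ _))
          (≤-<-trans (lastHits c j (Last.extends st))
            (subst (λ z → a j + (ind (hadj H (vₘ , j) (v₁ , z)) + _) < f vₘ j) (sym (Last.atV₁ st)) room)))
      agrees : ∀ u → T (Out u) → recolour c vₘ j u ≡ c′ u
      agrees u o = trans (recolour-other c vₘ j u (λ { refl → V∉Out lastI o })) (Last.extends st u o)

  -- v_m ranked first in K: its earlier neighbours all lie outside K, so it may
  -- take any colour j free for c′, provided the copy chosen for v_{m−1} (ranked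
  -- after v_m) is not adjacent to (v_m , j); v_1 absorbs v_m in its slack.
  finishFirst : ∀ {i₁} (st : First.Partial (suc p) i₁) j → a j < f vₘ j →
    ¬ T (hadj H (vₘ₋₁ , First.col st vₘ₋₁) (vₘ , j)) → Result
  finishFirst st j room avoid = recolour c vₘ j , First.finish (recolour c vₘ j) (λ _ → 0) valid , agrees
    where
      S = Coloured (suc p)
      c = First.col st
      rank-vₘ : rank true vₘ ≡ base
      rank-vₘ = trans (rank-K true lastI) (trans (cong (base +_) (posK-moved true lastI (eqb-refl lastI))) (+-identityʳ base))
      onlyOutside : ∀ u → T (S u ∧ (rank true u <ᵇ rank true vₘ) ∧ hadj H (vₘ , j) (u , c u)) →
                    (Σ (Fin m) λ l → V l ≡ u) ⊎ T (Out u) → T (Out u ∧ hadj H (vₘ , j) (u , c′ u))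
      onlyOutside u t (inj₂ o) = ∧-pair o (subst (λ z → T (hadj H (vₘ , j) (u , z))) (First.extends st u o)
                                    (∧-snd {rank true u <ᵇ rank true vₘ} (∧-snd {S u} t)))
      onlyOutside u t (inj₁ (l , refl)) = ⊥-elim (<⇒≱ (<ᵇ⇒< _ _ (∧-fst (∧-snd {S (V l)} t)))
              (≤-trans (≤-reflexive rank-vₘ) (subst (base ≤_) (sym (rank-K true l)) (m≤m+n base _))))
      absorb : ∀ w → T (S w) → (Σ (Fin m) λ l → V l ≡ w) ⊎ T (Out w) →
               0 + ind ((rank true vₘ <ᵇ rank true w) ∧ hadj H (w , c w) (vₘ , j)) ≤ First.slack w
      absorb w cw (inj₂ o) = ≤-reflexive (trans (ind-F (λ q → <-asym (rank-out<K true w lastI o) (<ᵇ⇒< _ _ (∧-fst q))))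
                                        (sym (First.slack-out w o)))
      absorb w cw (inj₁ (zero , refl)) =
        subst (0 + ind ((rank true vₘ <ᵇ rank true v₁) ∧ hadj H (v₁ , c v₁) (vₘ , j)) ≤_)
          (sym (ind-T (eqb-refl v₁))) (ind≤1 _)
      absorb w cw (inj₁ (suc l , refl)) =
        ≤-reflexive (trans (ind-F later) (sym (First.slack-other (V (suc l)) (λ e → 0≢1+n (sym (V-inj-toℕ e))))))
        where
          later : ¬ T ((rank true vₘ <ᵇ rank true (V (suc l))) ∧ hadj H (V (suc l) , c (V (suc l))) (vₘ , j))
          later q with K-nbr-vₘ (suc l) (edge-to-vₘ (V (suc l)) (c (V (suc l))) j cw
                         (subst T (hsym H (V (suc l) , _) (vₘ , j)) (∧-snd {rank true vₘ <ᵇ rank true (V (suc l))} q)))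
          ... | inj₁ ()
          ... | inj₂ e = avoid (subst (λ z → T (hadj H (V z , c (V z)) (vₘ , j))) e
                                  (∧-snd {rank true vₘ <ᵇ rank true (V (suc l))} q))
      valid : First.Valid (insert S vₘ) (recolour c vₘ j) (λ _ → 0)
      valid = First.addVertex S c First.slack (λ _ → 0) vₘ j (First.valid st) vₘ-fresh
        (≤-<-trans (≤-reflexive (+-identityʳ _)) (≤-<-trans (count-mono (λ u t → onlyOutside u t (locate u))) room))
        (λ w cw → absorb w cw (locate w))
      agrees : ∀ u → T (Out u) → recolour c vₘ j u ≡ c′ u
      agrees u o = trans (recolour-other c vₘ j u (λ { refl → V∉Out lastI o })) (First.extends st u o)

  x : Fin s → ℕ
  x i = hits Out c′ v₁ i

  -- Condition (i): v_1 has at most k − 3 neighbours outside K, because its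
  -- degree in K is at most its number of neighbours in V(K).
  nbrs-out-v₁ : nbrs Out v₁ + 3 ≤ k
  nbrs-out-v₁ = subst (_≤ k) (+-comm 3 X) (m≤o∸n⇒m+n≤o 3 X≤k 3≤k∸X)
    where
      X = nbrs Out v₁
      inside : degK K zero ≤ countFin (λ u → adj G v₁ u ∧ not (Out u))
      inside = count-inj (kadj K zero) _ V (λ a b → vinj K a b)
                 (λ l t → ∧-pair (kedge K zero l t) (not-intro (V∉Out l)))
      X+degK≤deg : X + degK K zero ≤ deg G v₁
      X+degK≤deg = subst (X + degK K zero ≤_) (sym (count-split (adj G v₁) Out))
        (+-mono-≤ (≤-reflexive (count-cong (λ u → ∧-comm (Out u) (adj G v₁ u)))) inside)
      3≤k∸X : 3 ≤ k ∸ X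
      3≤k∸X = ≤-trans cond-i (∸-monoʳ-≤ k (m+n≤o⇒m≤o∸n X X+degK≤deg))
      X≤k : X ≤ k
      X≤k = <⇒≤ (m∸n≢0⇒n<m (λ e → <⇒≱ (s≤s z≤n) (subst (3 ≤_) e 3≤k∸X)))

  v₁≢vₘ₋₁ : 1 ≤ p → ¬ v₁ ≡ vₘ₋₁
  v₁≢vₘ₋₁ 1≤p e = <-irrefl (trans (V-inj-toℕ e) toℕ-prevI) 1≤p

  vₘ₋₁≡v₁ : p ≡ 0 → vₘ₋₁ ≡ v₁
  vₘ₋₁≡v₁ p≡0 = cong V (toℕ-injective (trans toℕ-prevI p≡0))

  v₁≢vₘ : ¬ v₁ ≡ vₘ
  v₁≢vₘ e with V-inj e
  ... | ()

  vₘ₋₁≢vₘ : ¬ vₘ₋₁ ≡ vₘ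
  vₘ₋₁≢vₘ e = <-irrefl (trans (sym toℕ-prevI) (trans (V-inj-toℕ e) toℕ-lastI)) (n<1+n p)

  nbrs-out-vₘ : nbrs Out vₘ + 1 ≤ k
  nbrs-out-vₘ = subst (_≤ k) (+-comm 1 _) (≤-trans
    (nbrs-insert Out vₘ v₁ (V∉Out zero) (Equivalence.from (nbrs-vₘ zero) (inj₁ refl)))
    (≤-trans (nbrs≤deg _ vₘ) deg-vₘ))

  nbrs-out-vₘ′ : 1 ≤ p → nbrs Out vₘ + 2 ≤ k
  nbrs-out-vₘ′ 1≤p = subst (_≤ k) (+-comm 2 _) (≤-trans (s≤s
    (nbrs-insert Out vₘ v₁ (V∉Out zero) (Equivalence.from (nbrs-vₘ zero) (inj₁ refl))))
    (≤-trans (nbrs-insert (insert Out v₁) vₘ vₘ₋₁ vₘ₋₁-new (Equivalence.from (nbrs-vₘ prevI) (inj₂ refl)))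
    (≤-trans (nbrs≤deg _ vₘ) deg-vₘ)))
    where
      vₘ₋₁-new : ¬ T (insert Out v₁ vₘ₋₁)
      vₘ₋₁-new t with ∨-cases {Out vₘ₋₁} t
      ... | inj₁ o = V∉Out prevI o
      ... | inj₂ q = v₁≢vₘ₋₁ 1≤p (sym (eqb-sound q))

  noDoubleRoom : ∀ v i z → ¬ z + 2 < f v i
  noDoubleRoom v i z lt = <⇒≱ lt (≤-trans (f≤2 v i) (m≤n+m 2 z))

  partner : Fin s → Fin s → Bool
  partner i j = hadj H (v₁ , i) (vₘ , j)

  partner-sym : ∀ i j → ind (hadj H (vₘ , j) (v₁ , i)) ≡ ind (partner i j)
  partner-sym i j = cong ind (hsym H (vₘ , j) (v₁ , i))

  partner-sum : ∀ j → sumFin (λ i → ind (partner i j)) ≤ 1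
  partner-sum j = subst (_≤ 1) (count≡sum (λ i → partner i j)) (partners≤1 vₘ v₁ j (λ e → v₁≢vₘ (sym e)))

  partner-pair : ∀ j₁ j₂ → sumFin (λ i → ind (partner i j₁) + ind (partner i j₂)) ≤ 2
  partner-pair j₁ j₂ = ≤-trans (≤-reflexive (sumFin-+ (λ i → ind (partner i j₁)) (λ i → ind (partner i j₂))))
                               (+-mono-≤ (partner-sum j₁) (partner-sum j₂))

  v₁-room : (e : Fin s → ℕ) → sumFin e ≤ 2 → ∃ λ i → x i + e i < f v₁ i
  v₁-room e Σe≤2 = freeColour Out c′ v₁ (V∉Out zero) e (<-≤-trans (+-monoʳ-< (nbrs Out v₁) (s≤s Σe≤2))
    (≤-trans nbrs-out-v₁ (|f|≥k v₁)))

  v₁-avoiding : ∀ j → ∃ λ i → x i < f v₁ i × ind (partner i j) ≡ 0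
  v₁-avoiding j with v₁-room (λ i → ind (partner i j) + ind (partner i j)) (partner-pair j j)
  ... | i , room = i , ≤-<-trans (m≤m+n (x i) _) room , ind-F notPartner
    where
      notPartner : ¬ T (partner i j)
      notPartner t = noDoubleRoom v₁ i (x i) (subst (λ z → x i + (z + z) < f v₁ i) (ind-T t) room)

  unhit : ∀ {y z} → ¬ T (hadj H y z) → ind (hadj H z y) ≡ 0
  unhit {y} {z} ¬yz = ind-F (λ t → ¬yz (subst T (hsym H z y) t))

  -- Some colour of v_m is free for c′, as v_m has at most k − 1 outside neighbours.
  vₘ-free : ∃ λ j → a j < f vₘ j
  vₘ-free = pigeonhole a (f vₘ) (≤-<-trans (hits-sum Out c′ vₘ (V∉Out lastI))
    (<-≤-trans (subst (_≤ k) (+-comm (nbrs Out vₘ) 1) nbrs-out-vₘ) (|f|≥k vₘ)))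

  record FreePair : Set where
    field
      j₁ j₂ : Fin s
      distinct : ¬ j₁ ≡ j₂
      free : ∀ j → j ≡ j₁ ⊎ j ≡ j₂ → a j < f vₘ j

  freePair : 1 ≤ p → (∀ j → ¬ 2 + a j ≤ f vₘ j) → FreePair
  freePair 1≤p tight = record { j₁ = j₁ ; j₂ = j₂ ; distinct = distinct ; free = free }
    where
      j₁ = proj₁ vₘ-free
      Σe≤1 : sumFin (λ j → ind (eqb j j₁)) ≤ 1
      Σe≤1 = subst (_≤ 1) (count≡sum (λ j → eqb j j₁))
        (count-unique (λ j → eqb j j₁) (λ u u′ t t′ → trans (eqb-sound t) (sym (eqb-sound t′))))
      second : ∃ λ j → a j + ind (eqb j j₁) < f vₘ j
      second = freeColour Out c′ vₘ (V∉Out lastI) (λ j → ind (eqb j j₁))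
        (<-≤-trans (+-monoʳ-< (nbrs Out vₘ) (s≤s Σe≤1))
          (≤-trans (nbrs-out-vₘ′ 1≤p) (|f|≥k vₘ)))
      j₂ = proj₁ second
      distinct : ¬ j₁ ≡ j₂
      distinct e = tight j₁ (subst (_≤ f vₘ j₁) (cong suc (+-comm (a j₁) 1))
        (subst (λ z → a j₁ + z < f vₘ j₁) (ind-T (eqb-refl j₁))
          (subst (λ z → a z + ind (eqb z j₁) < f vₘ z) (sym e) (proj₂ second))))
      free : ∀ j → j ≡ j₁ ⊎ j ≡ j₂ → a j < f vₘ j
      free j (inj₁ refl) = proj₂ vₘ-free
      free j (inj₂ refl) = ≤-<-trans (m≤m+n (a j) _) (proj₂ second)

  shortCase : p ≡ 0 → Result
  shortCase p≡0 with vₘ-free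
  ... | j , aj<f with v₁-avoiding j
  ...   | i , room , notPartner = finishLast st j bound
    where
      st = Last.colourAllButLast i (subst (_< f v₁ i) (sym (+-identityʳ (x i))) room)
      noHit : ind (hadj H (vₘ , j) (v₁ , i)) ≡ 0
      noHit = trans (partner-sym i j) notPartner
      bound : a j + (ind (hadj H (vₘ , j) (v₁ , i)) + ind (hadj H (vₘ , j) (vₘ₋₁ , Last.col st vₘ₋₁))) < f vₘ j
      bound rewrite vₘ₋₁≡v₁ p≡0 | Last.atV₁ st | noHit = subst (_< f vₘ j) (sym (+-identityʳ (a j))) aj<f

  -- m ≥ 3 and v_m has a free colour j with two spare units: colour v_1 off the
  -- partner of (v_m , j); v_m, ranked last, sees at most v_{m−1} from K.
  roomyCase : ∀ j → 2 + a j ≤ f vₘ j → Result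
  roomyCase j roomy with v₁-avoiding j
  ... | i , room , notPartner = finishLast st j (begin-strict
        a j + (ind (hadj H (vₘ , j) (v₁ , i)) + ind (hadj H (vₘ , j) (vₘ₋₁ , Last.col st vₘ₋₁)))
      ≡⟨ cong (λ z → a j + (z + ind (hadj H (vₘ , j) (vₘ₋₁ , Last.col st vₘ₋₁)))) (trans (partner-sym i j) notPartner) ⟩
        a j + ind (hadj H (vₘ , j) (vₘ₋₁ , Last.col st vₘ₋₁))
      ≤⟨ +-monoʳ-≤ (a j) (ind≤1 _) ⟩
        a j + 1
      <⟨ subst (_≤ f vₘ j) (cong suc (+-comm 1 (a j))) roomy ⟩
        f vₘ j ∎)
    where
      open ≤-Reasoning
      st = Last.colourAllButLast i (subst (_< f v₁ i) (sym (+-identityʳ (x i))) room)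

  pairCase : FreePair → Result
  pairCase P with any? (λ i → 2 + x i ≤? f v₁ i)
  ... | yes (i , roomy) = finishFirst st j (free j j∈) avoid
    where
      open FreePair P
      st = First.colourAllButLast i (subst (λ z → x i + z < f v₁ i) (sym (ind-T (eqb-refl v₁)))
                                       (subst (_≤ f v₁ i) (cong suc (+-comm 1 (x i))) roomy))
      dodged = dodge vₘ₋₁ vₘ (First.col st vₘ₋₁) j₁ j₂ vₘ₋₁≢vₘ distinct
      j = proj₁ dodged
      j∈ = proj₁ (proj₂ dodged)
      avoid = proj₂ (proj₂ dodged)
  ... | no tight with v₁-room (λ i → ind (partner i (FreePair.j₁ P)) + ind (partner i (FreePair.j₂ P)))
                             (partner-pair (FreePair.j₁ P) (FreePair.j₂ P))
  ...   | i , room = finishLast st j (subst (_< f vₘ j) (sym bound) (free j j∈))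
    where
      open FreePair P
      st = Last.colourAllButLast i (≤-<-trans (≤-reflexive (+-identityʳ (x i))) (≤-<-trans (m≤m+n (x i) _) room))
      dodged = dodge vₘ₋₁ vₘ (Last.col st vₘ₋₁) j₁ j₂ vₘ₋₁≢vₘ distinct
      j = proj₁ dodged
      j∈ = proj₁ (proj₂ dodged)
      -- a partner of (v_1 , i) would use up v_1's only spare unit
      notPartner : ∀ j′ → j′ ≡ j₁ ⊎ j′ ≡ j₂ → ind (partner i j′) ≡ 0
      notPartner j′ j′∈ = ind-F (λ t → tight (i , subst (_≤ f v₁ i) (cong suc (+-comm (x i) 1))
        (≤-<-trans (+-monoʳ-≤ (x i) (counted j′∈ (ind-T t))) room)))
        where
          counted : j′ ≡ j₁ ⊎ j′ ≡ j₂ → ind (partner i j′) ≡ 1 → 1 ≤ ind (partner i j₁) + ind (partner i j₂)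
          counted (inj₁ refl) e = ≤-trans (≤-reflexive (sym e)) (m≤m+n _ _)
          counted (inj₂ refl) e = ≤-trans (≤-reflexive (sym e)) (m≤n+m _ _)
      bound : a j + (ind (hadj H (vₘ , j) (v₁ , i)) + ind (hadj H (vₘ , j) (vₘ₋₁ , Last.col st vₘ₋₁))) ≡ a j
      bound rewrite partner-sym i j | notPartner j j∈ | unhit (proj₂ (proj₂ dodged)) = +-identityʳ (a j)

  longCase : 1 ≤ p → Result
  longCase 1≤p with any? (λ j → 2 + a j ≤? f vₘ j)
  ... | yes (j , roomy) = roomyCase j roomy
  ... | no tight = pairCase (freePair 1≤p (λ j roomy → tight (j , roomy)))


lemma6 : ∀ {n s : ℕ} (k : ℕ) → 3 ≤ k
    → (G : Graph n) (H : Cover G s) (f : Fin n → Fin s → ℕ)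
    → (∀ v i → f v i ≤ 2)
    → (p : ℕ) (K : Subgraph G (suc (suc p)))
    → 3 ≤ k ∸ (deg G (vert K zero) ∸ degK K zero)
    → deg G (vert K (fromℕ (suc p))) ≤ k
    → (∀ j → Edge G (vert K (fromℕ (suc p))) (vert K j)
             ⇔ (j ≡ zero ⊎ j ≡ inject₁ (fromℕ p)))
    → (∀ (j : Fin (suc (suc p))) → 1 ≤ toℕ j → toℕ j ≤ p
         → countFin (λ u → adj G (vert K j) u ∧ earlierOrOutside K j u) ≤ k ∸ 1)
    → (∀ v → k ≤ size f v)
    → (c′ : Fin n → Fin s) → IsDPFColoring G H f (outsideK K) c′
    → Σ (Fin n → Fin s) λ c →
        IsDPFColoring G H f allTrue c × (∀ v → T (outsideK K v) → c v ≡ c′ v)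
lemma6 k k≥3 G H f f≤2 p K cond-i deg-vₘ nbrs-vₘ cond-iii |f|≥k c′ (r′ , r′-inj , r′-ok) =
  bySize (1 ≤? p)
  where
    open Extension k k≥3 G H f f≤2 p K cond-i deg-vₘ nbrs-vₘ cond-iii |f|≥k c′ r′ r′-inj r′-ok
    bySize : Dec (1 ≤ p) → Result
    bySize (yes 1≤p) = longCase 1≤p
    bySize (no 1≰p) = shortCase (n<1⇒n≡0 (≰⇒> 1≰p))
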